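{- Let $f,g\in\mathbf{Z}[t]$ be coprime (in $\mathbf{Q}[t]$) polynomials of degrees $r$ and $s$, at least one positive; write $\max(r/4,s/6)=n/m$ with $n,m$ coprime positive integers, and assume $n=1$ or $m=1$. For $(a,b)\in\mathbf{Z}^2$, $b\ne0$, put $A=b^{4n}f(a/b^m)$ and $B=b^{6n}g(a/b^m)$. Fix $\kappa>0$ and for $X\ge1$ let $S_2(X)$ be the set of $(a,b)\in\mathbf{Z}^2$ with $a,b$ coprime, $b>0$, $|a|<\kappa X^{m/12n}$, $|b|<\kappa X^{1/12n}$, and $4A^3+27B^2\ne0$; let $S_3(X)$ be the image of $S_2(X)$ under $(a,b)\mapsto(A,B)$. Then there is a constant $M$, independent of $X$, such that every fiber of the map $S_2(X)\to S_3(X)$ has cardinality at most $M$.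
   Formalization: The constant κ and the parameter X range over the rationals. -}

module Defs where

open import Data.Nat as ℕ using (ℕ; zero; suc; _∸_)
open import Data.Integer as ℤ using (ℤ; +_; +[1+_])
open import Data.Integer.Coprimality using () renaming (Coprime to ℤCoprime)
open import Data.Rational as ℚ using (ℚ; 0ℚ; 1ℚ; _+_; _*_; _<_; _≤_)
open import Data.Nat.Properties using (m^n≢0)
open import Data.List using (List; []; _∷_; foldr; map)
open import Data.Product using (_×_; ∃)
open import Relation.Binary.PropositionalEquality using (_≡_; _≢_)

fromℤ : ℤ → ℚ
fromℤ z = z ℚ./ 1

-- Polynomials are coefficient lists, lowest degree first: c₀ ∷ c₁ ∷ … ∷ [].
-- Trailing zeros are allowed; all notions below only look at coefficients.

coeffℤ : List ℤ → ℕ → ℤ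
coeffℤ []       _       = + 0
coeffℤ (c ∷ cs) zero    = c
coeffℤ (c ∷ cs) (suc i) = coeffℤ cs i

coeffℚ : List ℚ → ℕ → ℚ
coeffℚ []       _       = 0ℚ
coeffℚ (c ∷ cs) zero    = c
coeffℚ (c ∷ cs) (suc i) = coeffℚ cs i

toℚ[t] : List ℤ → List ℚ
toℚ[t] = map fromℤ

HasDegree : List ℤ → ℕ → Set
HasDegree p r = (coeffℤ p r ≢ + 0) × (∀ i → r ℕ.< i → coeffℤ p i ≡ + 0)

sumUpTo : (ℕ → ℚ) → ℕ → ℚ
sumUpTo f zero    = f 0
sumUpTo f (suc k) = sumUpTo f k + f (suc k)

mulCoeff : List ℚ → List ℚ → ℕ → ℚ
mulCoeff h q k = sumUpTo (λ i → coeffℚ h i * coeffℚ q (k ∸ i)) k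

_∣ℚ[t]_ : List ℚ → List ℚ → Set
h ∣ℚ[t] p = ∃ λ (q : List ℚ) → ∀ k → coeffℚ p k ≡ mulCoeff h q k

CoprimeInℚ[t] : List ℤ → List ℤ → Set
CoprimeInℚ[t] f g = ∀ (h : List ℚ) → h ∣ℚ[t] toℚ[t] f → h ∣ℚ[t] toℚ[t] g →
                    ∀ k → 1 ℕ.≤ k → coeffℚ h k ≡ 0ℚ

eval : List ℤ → ℚ → ℚ
eval p x = foldr (λ c acc → fromℤ c + x * acc) 0ℚ p

_^ℚ_ : ℚ → ℕ → ℚ
x ^ℚ zero  = 1ℚ
x ^ℚ suc k = x * (x ^ℚ k)

-- b^e · p(a / b^m) for b > 0 (value for b ≤ 0 is irrelevant: such pairs are
-- excluded from S₂ by the condition b > 0)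
weightedEval : List ℤ → ℕ → ℕ → ℤ → ℤ → ℚ
weightedEval p e m a +[1+ k ] =
  (fromℤ +[1+ k ] ^ℚ e) * eval p (ℚ._/_ a (suc k ℕ.^ m) {{m^n≢0 (suc k) m}})
weightedEval p e m a _ = 0ℚ

Aof : List ℤ → ℕ → ℕ → ℤ → ℤ → ℚ
Aof f n m a b = weightedEval f (4 ℕ.* n) m a b

Bof : List ℤ → ℕ → ℕ → ℤ → ℤ → ℚ
Bof g n m a b = weightedEval g (6 ℕ.* n) m a b

-- (a,b) ∈ S₂(X) (for parameters κ > 0, X ≥ 1).
-- |a| < κ X^{m/12n}  is written  |a|^{12n} < κ^{12n} X^m   (both sides ≥ 0)
-- |b| < κ X^{1/12n}  is written  |b|^{12n} < κ^{12n} X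
InS₂ : List ℤ → List ℤ → ℕ → ℕ → ℚ → ℚ → ℤ → ℤ → Set
InS₂ f g n m κ X a b =
  ℤCoprime a b ×
  ℤ.0ℤ ℤ.< b ×
  (fromℤ (+ ℤ.∣ a ∣) ^ℚ (12 ℕ.* n) < (κ ^ℚ (12 ℕ.* n)) * (X ^ℚ m)) ×
  (fromℤ (+ ℤ.∣ b ∣) ^ℚ (12 ℕ.* n) < (κ ^ℚ (12 ℕ.* n)) * X) ×
  (fromℤ (+ 4) * (Aof f n m a b ^ℚ 3) + fromℤ (+ 27) * (Bof g n m a b ^ℚ 2) ≢ 0ℚ)

module Submission where

-- Put F = f, G = g in ℚ[t] and fix a fiber, i.e. values (A , B).
-- For (a , b) in the fiber with b > 0 let t = a / b^m; then A = b^{4n} F(t) and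
-- B = b^{6n} G(t), hence t is a root of the relation polynomial
--     P(x) = B² F(x)³ − A³ G(x)²,
-- and t determines (a , b) because (A , B) ≠ (0 , 0) (the discriminant
-- 4A³ + 27B² is nonzero).  So a fiber has fewer points than P has coefficients,
-- which is at most M = max (len F³) (len G²), independent of X, κ, A and B --
-- provided P is not the zero function.  That is the algebraic heart: from a
-- Bézout identity c = uF + vG (c ≠ 0, from coprimality via Euclid) one gets
-- c⁵ = F³X + G³Y, and B²F³ = A³G² turns this into B²c⁵ = G²W, A³c⁵ = F³W;
-- a nonconstant polynomial cannot divide a nonzero constant, so A ≠ 0 forces
-- deg F = 0 and B ≠ 0 forces deg G = 0, contradicting r > 0 or s > 0.
-- The file develops: arithmetic in ℚ; polynomials as coefficient lists with
-- evaluation, root counting and the identity theorem; degrees; division with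
-- remainder and Euclid's algorithm; the relation polynomial; fibers; the theorem.

open import Defs
open import Data.Nat as ℕ using (ℕ; NonZero; zero; suc; z≤n; s≤s)
import Data.Nat.Properties as ℕP
open import Data.Nat.Coprimality using (Coprime)
open import Data.Integer as ℤ using (ℤ; +_; +[1+_]; -[1+_])
import Data.Integer.Properties as ℤP
open import Data.Rational as ℚ using (ℚ; 0ℚ; 1ℚ; _⊔_; _+_; _*_; _-_; -_; _<_)
import Data.Rational.Properties as ℚP
open import Data.Rational.Unnormalised using (mkℚᵘ; *≡*)
open import Data.Rational.Solver using (module +-*-Solver)
open +-*-Solver using (solve; _:=_; _:+_; _:*_; _:-_; :-_; _:^_; con)
open import Data.List using (List; []; _∷_; length; map; applyUpTo)
import Data.List.Properties as ListP
open import Data.List.Relation.Unary.All as All using (All; []; _∷_)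
import Data.List.Relation.Unary.All.Properties as AllP
open import Data.List.Relation.Unary.Unique.Propositional using (Unique)
import Data.List.Relation.Unary.Unique.Propositional.Properties as UniqueP
open import Data.List.Relation.Unary.AllPairs using ([]; _∷_)
open import Data.Product using (_×_; _,_; ∃; Σ-syntax; proj₁; proj₂)
open import Data.Sum using (_⊎_; inj₁; inj₂)
open import Relation.Nullary using (¬_; yes; no; contradiction)
open import Relation.Binary.PropositionalEquality
open import Relation.Binary.Definitions using (tri<; tri≈; tri>)
open ≡-Reasoning

*≡0⇒≡0 : ∀ x y → x * y ≡ 0ℚ → x ≢ 0ℚ → y ≡ 0ℚ
*≡0⇒≡0 x y xy≡0 x≢0 = begin
    y                 ≡⟨ sym (ℚP.*-identityˡ y) ⟩
    1ℚ * y            ≡⟨ cong (_* y) (sym (ℚP.*-inverseˡ x)) ⟩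
    ℚ.1/ x * x * y    ≡⟨ ℚP.*-assoc (ℚ.1/ x) x y ⟩
    ℚ.1/ x * (x * y)  ≡⟨ cong (ℚ.1/ x *_) xy≡0 ⟩
    ℚ.1/ x * 0ℚ       ≡⟨ ℚP.*-zeroʳ (ℚ.1/ x) ⟩
    0ℚ                ∎
  where
  instance
    x-nonZero : ℚ.NonZero x
    x-nonZero = ℚ.≢-nonZero x≢0

*-nonZero : ∀ {x y} → x ≢ 0ℚ → y ≢ 0ℚ → x * y ≢ 0ℚ
*-nonZero {x} {y} x≢0 y≢0 xy≡0 = y≢0 (*≡0⇒≡0 x y xy≡0 x≢0)

^-nonZero : ∀ {x} k → x ≢ 0ℚ → x ^ℚ k ≢ 0ℚ
^-nonZero zero    x≢0 ()
^-nonZero (suc k) x≢0 = *-nonZero x≢0 (^-nonZero k x≢0)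

^≡0⇒≡0 : ∀ x k → x ^ℚ k ≡ 0ℚ → x ≡ 0ℚ
^≡0⇒≡0 x k xᵏ≡0 with x ℚP.≟ 0ℚ
... | yes x≡0 = x≡0
... | no  x≢0 = contradiction xᵏ≡0 (^-nonZero k x≢0)

x-y≡0⇒x≡y : ∀ x y → x - y ≡ 0ℚ → x ≡ y
x-y≡0⇒x≡y x y x-y≡0 = begin
    x           ≡⟨ solve 2 (λ x y → x := x :- y :+ y) refl x y ⟩
    x - y + y   ≡⟨ cong (_+ y) x-y≡0 ⟩
    0ℚ + y      ≡⟨ ℚP.+-identityˡ y ⟩
    y           ∎

x≡y⇒x-y≡0 : ∀ {x y} → x ≡ y → x - y ≡ 0ℚ
x≡y⇒x-y≡0 {x} refl = ℚP.+-inverseʳ x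

*-cancelʳ : ∀ x y z → z ≢ 0ℚ → x * z ≡ y * z → x ≡ y
*-cancelʳ x y z z≢0 xz≡yz = x-y≡0⇒x≡y x y (*≡0⇒≡0 z (x - y) z[x-y]≡0 z≢0)
  where
  z[x-y]≡0 : z * (x - y) ≡ 0ℚ
  z[x-y]≡0 = trans (solve 3 (λ x y z → z :* (x :- y) := x :* z :- y :* z) refl x y z)
                   (x≡y⇒x-y≡0 xz≡yz)

divides : ∀ {b} → b ≢ 0ℚ → ∀ a → ∃ λ α → α * b ≡ a
divides {b} b≢0 a = a * ℚ.1/ b , (begin
    a * ℚ.1/ b * b    ≡⟨ ℚP.*-assoc a (ℚ.1/ b) b ⟩
    a * (ℚ.1/ b * b)  ≡⟨ cong (a *_) (ℚP.*-inverseˡ b) ⟩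
    a * 1ℚ            ≡⟨ ℚP.*-identityʳ a ⟩
    a                 ∎)
  where
  instance
    b-nonZero : ℚ.NonZero b
    b-nonZero = ℚ.≢-nonZero b≢0

^-+ : ∀ x a b → x ^ℚ (a ℕ.+ b) ≡ x ^ℚ a * x ^ℚ b
^-+ x zero    b = sym (ℚP.*-identityˡ _)
^-+ x (suc a) b = trans (cong (x *_) (^-+ x a b)) (sym (ℚP.*-assoc x _ _))

^-* : ∀ x a b → x ^ℚ (a ℕ.* b) ≡ (x ^ℚ a) ^ℚ b
^-* x a zero    = cong (x ^ℚ_) (ℕP.*-zeroʳ a)
^-* x a (suc b) = begin
    x ^ℚ (a ℕ.* suc b)          ≡⟨ cong (x ^ℚ_) (ℕP.*-suc a b) ⟩
    x ^ℚ (a ℕ.+ a ℕ.* b)        ≡⟨ ^-+ x a (a ℕ.* b) ⟩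
    x ^ℚ a * x ^ℚ (a ℕ.* b)     ≡⟨ cong (x ^ℚ a *_) (^-* x a b) ⟩
    x ^ℚ a * (x ^ℚ a) ^ℚ b      ∎

0<1 : 0ℚ < 1ℚ
0<1 = ℚP.positive⁻¹ 1ℚ

^-pos : ∀ {x} → 0ℚ < x → ∀ k → 0ℚ < x ^ℚ k
^-pos 0<x zero            = 0<1
^-pos {x} 0<x (suc k) = subst (_< x * x ^ℚ k) (ℚP.*-zeroˡ (x ^ℚ k))
  (ℚP.*-monoˡ-<-pos (x ^ℚ k) {{ℚ.positive (^-pos 0<x k)}} 0<x)

^-strictMono : ∀ {x y} → 0ℚ < x → x < y → ∀ k → x ^ℚ suc k < y ^ℚ suc k
^-strictMono {x} {y} 0<x x<y k = ℚP.<-≤-trans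
  (ℚP.*-monoˡ-<-pos (x ^ℚ k) {{ℚ.positive (^-pos 0<x k)}} x<y)
  (ℚP.*-monoˡ-≤-nonNeg y {{ℚ.nonNegative (ℚP.<⇒≤ (ℚP.<-trans 0<x x<y))}} (^-mono k))
  where
  ^-mono : ∀ k → x ^ℚ k ℚ.≤ y ^ℚ k
  ^-mono zero    = ℚP.≤-refl
  ^-mono (suc k) = ℚP.<⇒≤ (^-strictMono 0<x x<y k)

^-injective : ∀ {x y} k → 0ℚ < x → 0ℚ < y → x ^ℚ suc k ≡ y ^ℚ suc k → x ≡ y
^-injective {x} {y} k 0<x 0<y xᵏ≡yᵏ with ℚP.<-cmp x y
... | tri< x<y _ _ = contradiction xᵏ≡yᵏ (ℚP.<⇒≢ (^-strictMono 0<x x<y k))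
... | tri≈ _ x≡y _ = x≡y
... | tri> _ _ y<x = contradiction (sym xᵏ≡yᵏ) (ℚP.<⇒≢ (^-strictMono 0<y y<x k))

^-*-cancel : ∀ {x y c} k → 0 ℕ.< k → 0ℚ < x → 0ℚ < y → c ≢ 0ℚ →
             x ^ℚ k * c ≡ y ^ℚ k * c → x ≡ y
^-*-cancel {x} {y} {c} (suc k) _ 0<x 0<y c≢0 eq =
  ^-injective k 0<x 0<y (*-cancelʳ (x ^ℚ suc k) (y ^ℚ suc k) c c≢0 eq)

/-injectiveˡ : ∀ a a' N .{{_ : NonZero N}} → a ℚ./ N ≡ a' ℚ./ N → a ≡ a'
/-injectiveˡ a a' (suc N) eq with ℚP./-injective-≃ (mkℚᵘ a N) (mkℚᵘ a' N) eq
... | *≡* aN≡a'N = ℤP.*-cancelʳ-≡ a a' (+ suc N) aN≡a'N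

fromℤ-injective : ∀ {a a'} → fromℤ a ≡ fromℤ a' → a ≡ a'
fromℤ-injective {a} {a'} = /-injectiveˡ a a' 1

Poly : Set
Poly = List ℚ

evalP : Poly → ℚ → ℚ
evalP []       x = 0ℚ
evalP (c ∷ cs) x = c + x * evalP cs x

Root : Poly → ℚ → Set
Root p t = evalP p t ≡ 0ℚ

evalP-at-0 : ∀ c cs → evalP (c ∷ cs) 0ℚ ≡ c
evalP-at-0 c cs = trans (cong (λ z → c + z) (ℚP.*-zeroˡ (evalP cs 0ℚ))) (ℚP.+-identityʳ c)

synthDiv : ℚ → Poly → Poly
synthDiv t []       = []
synthDiv t (d ∷ ds) = evalP (d ∷ ds) t ∷ synthDiv t ds

synthDiv-length : ∀ t cs → length (synthDiv t cs) ≡ length cs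
synthDiv-length t []       = refl
synthDiv-length t (d ∷ ds) = cong suc (synthDiv-length t ds)

synthDiv-eval : ∀ t x cs →
  x * evalP cs x ≡ t * evalP cs t + (x - t) * evalP (synthDiv t cs) x
synthDiv-eval t x []       =
  solve 2 (λ x t → x :* con 0ℚ := t :* con 0ℚ :+ (x :- t) :* con 0ℚ) refl x t
synthDiv-eval t x (d ∷ ds) = begin
    x * (d + x * evalP ds x)
      ≡⟨ cong (λ z → x * (d + z)) (synthDiv-eval t x ds) ⟩
    x * (d + (t * e + (x - t) * q))
      ≡⟨ solve 5 (λ x t d e q → x :* (d :+ (t :* e :+ (x :- t) :* q))
                   := t :* (d :+ t :* e) :+ (x :- t) :* ((d :+ t :* e) :+ x :* q))
               refl x t d e q ⟩
    t * (d + t * e) + (x - t) * ((d + t * e) + x * q) ∎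
  where
  e = evalP ds t
  q = evalP (synthDiv t ds) x

factor : ∀ c cs t → Root (c ∷ cs) t →
         ∀ x → evalP (c ∷ cs) x ≡ (x - t) * evalP (synthDiv t cs) x
factor c cs t root x = begin
    c + x * evalP cs x
      ≡⟨ cong (λ z → c + z) (synthDiv-eval t x cs) ⟩
    c + (t * evalP cs t + (x - t) * q)
      ≡⟨ sym (ℚP.+-assoc c _ _) ⟩
    (c + t * evalP cs t) + (x - t) * q
      ≡⟨ cong (_+ (x - t) * q) root ⟩
    0ℚ + (x - t) * q
      ≡⟨ ℚP.+-identityˡ _ ⟩
    (x - t) * q ∎
  where q = evalP (synthDiv t cs) x

cofactor-roots : ∀ c cs t R → Root (c ∷ cs) t → All (t ≢_) R →
                 All (Root (c ∷ cs)) R → All (Root (synthDiv t cs)) R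
cofactor-roots c cs t []      root _             _           = []
cofactor-roots c cs t (y ∷ R) root (t≢y ∷ t≢R) (ry ∷ rR) =
  *≡0⇒≡0 (y - t) _ (trans (sym (factor c cs t root y)) ry)
         (λ y-t≡0 → t≢y (sym (x-y≡0⇒x≡y y t y-t≡0)))
  ∷ cofactor-roots c cs t R root t≢R rR

manyRoots⇒vanishing : ∀ (R : Poly) p → Unique R → All (Root p) R →
                      length p ℕ.≤ length R → ∀ x → evalP p x ≡ 0ℚ
manyRoots⇒vanishing R       []       _             _           _         x = refl
manyRoots⇒vanishing []      (c ∷ cs) _             _           ()
manyRoots⇒vanishing (t ∷ R) (c ∷ cs) (t∉R ∷ uR) (rt ∷ rR) (s≤s len≤) x = begin
    evalP (c ∷ cs) x                 ≡⟨ factor c cs t rt x ⟩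
    (x - t) * evalP (synthDiv t cs) x ≡⟨ cong ((x - t) *_) cofactor≡0 ⟩
    (x - t) * 0ℚ                     ≡⟨ ℚP.*-zeroʳ (x - t) ⟩
    0ℚ                               ∎
  where
  cofactor≡0 : evalP (synthDiv t cs) x ≡ 0ℚ
  cofactor≡0 = manyRoots⇒vanishing R (synthDiv t cs) uR
    (cofactor-roots c cs t R rt t∉R rR)
    (subst (ℕ._≤ length R) (sym (synthDiv-length t cs)) len≤) x

distinctRoots<length : ∀ p (R : Poly) → ¬ (∀ x → evalP p x ≡ 0ℚ) →
                       Unique R → All (Root p) R → length R ℕ.< length p
distinctRoots<length p R p≢0 uR rR with length p ℕ.≤? length R
... | yes len≤ = contradiction (manyRoots⇒vanishing R p uR rR len≤) p≢0
... | no  len≰ = ℕP.≰⇒> len≰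

nonzeroPoints : ℕ → Poly
nonzeroPoints = applyUpTo (λ i → fromℤ (+ suc i))

nonzeroPoints-unique : ∀ n → Unique (nonzeroPoints n)
nonzeroPoints-unique n = UniqueP.applyUpTo⁺₁ _ n
  (λ i<j _ eq → ℕP.<⇒≢ i<j (ℕP.suc-injective (ℤP.+-injective (fromℤ-injective eq))))

nonzeroPoints-nonZero : ∀ n → All (_≢ 0ℚ) (nonzeroPoints n)
nonzeroPoints-nonZero n = AllP.applyUpTo⁺₂ _ n (λ i eq → contradiction (fromℤ-injective {+ suc i} {+ 0} eq) λ ())

vanishing⇒zeroCoeffs : ∀ p → (∀ x → evalP p x ≡ 0ℚ) → ∀ k → coeffℚ p k ≡ 0ℚ
vanishing⇒zeroCoeffs []       _   _ = refl
vanishing⇒zeroCoeffs (c ∷ cs) p≡0 = λ where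
    zero    → c≡0
    (suc k) → vanishing⇒zeroCoeffs cs cs≡0 k
  where
  c≡0 : c ≡ 0ℚ
  c≡0 = trans (sym (evalP-at-0 c cs)) (p≡0 0ℚ)
  -- at y ≠ 0 the value y·cs(y) = p(y) − c vanishes, so cs(y) does
  cs-root : ∀ {y} → y ≢ 0ℚ → Root cs y
  cs-root {y} y≢0 = *≡0⇒≡0 y (evalP cs y)
    (trans (sym (ℚP.+-identityˡ _)) (trans (cong (_+ y * evalP cs y) (sym c≡0)) (p≡0 y))) y≢0
  cs≡0 : ∀ x → evalP cs x ≡ 0ℚ
  cs≡0 = manyRoots⇒vanishing (nonzeroPoints (length cs)) cs
    (nonzeroPoints-unique _) (All.map cs-root (nonzeroPoints-nonZero _))
    (ℕP.≤-reflexive (sym (ListP.length-applyUpTo _ (length cs))))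

zeroCoeffs⇒vanishing : ∀ p → (∀ k → coeffℚ p k ≡ 0ℚ) → ∀ x → evalP p x ≡ 0ℚ
zeroCoeffs⇒vanishing []       _   x = refl
zeroCoeffs⇒vanishing (c ∷ cs) c≡0 x = begin
    c + x * evalP cs x  ≡⟨ cong₂ (λ c v → c + x * v) (c≡0 0) (zeroCoeffs⇒vanishing cs (λ k → c≡0 (suc k)) x) ⟩
    0ℚ + x * 0ℚ         ≡⟨ solve 1 (λ x → con 0ℚ :+ x :* con 0ℚ := con 0ℚ) refl x ⟩
    0ℚ                  ∎

infixl 6 _+ₚ_
infixr 7 _·ₚ_
infixl 7 _*ₚ_
infix  8 _^ₚ_

_+ₚ_ : Poly → Poly → Poly
[]      +ₚ q       = q
(a ∷ p) +ₚ []      = a ∷ p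
(a ∷ p) +ₚ (b ∷ q) = (a + b) ∷ (p +ₚ q)

_·ₚ_ : ℚ → Poly → Poly
c ·ₚ p = map (c *_) p

_*ₚ_ : Poly → Poly → Poly
[]       *ₚ q = []
(c ∷ cs) *ₚ q = c ·ₚ q +ₚ (0ℚ ∷ cs *ₚ q)

_^ₚ_ : Poly → ℕ → Poly
p ^ₚ zero  = 1ℚ ∷ []
p ^ₚ suc k = p *ₚ p ^ₚ k

eval-+ₚ : ∀ p q x → evalP (p +ₚ q) x ≡ evalP p x + evalP q x
eval-+ₚ []      q       x = sym (ℚP.+-identityˡ _)
eval-+ₚ (a ∷ p) []      x = sym (ℚP.+-identityʳ _)
eval-+ₚ (a ∷ p) (b ∷ q) x = begin
    (a + b) + x * evalP (p +ₚ q) x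
      ≡⟨ cong (λ v → (a + b) + x * v) (eval-+ₚ p q x) ⟩
    (a + b) + x * (evalP p x + evalP q x)
      ≡⟨ solve 5 (λ a b x u v → (a :+ b) :+ x :* (u :+ v) := (a :+ x :* u) :+ (b :+ x :* v))
               refl a b x (evalP p x) (evalP q x) ⟩
    (a + x * evalP p x) + (b + x * evalP q x) ∎

eval-·ₚ : ∀ c p x → evalP (c ·ₚ p) x ≡ c * evalP p x
eval-·ₚ c []      x = sym (ℚP.*-zeroʳ c)
eval-·ₚ c (a ∷ p) x = begin
    c * a + x * evalP (c ·ₚ p) x  ≡⟨ cong (λ v → c * a + x * v) (eval-·ₚ c p x) ⟩
    c * a + x * (c * evalP p x)   ≡⟨ solve 4 (λ c a x u → c :* a :+ x :* (c :* u) := c :* (a :+ x :* u))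
                                           refl c a x (evalP p x) ⟩
    c * (a + x * evalP p x)       ∎

eval-*ₚ : ∀ p q x → evalP (p *ₚ q) x ≡ evalP p x * evalP q x
eval-*ₚ []       q x = sym (ℚP.*-zeroˡ (evalP q x))
eval-*ₚ (c ∷ cs) q x = begin
    evalP (c ·ₚ q +ₚ (0ℚ ∷ cs *ₚ q)) x
      ≡⟨ eval-+ₚ (c ·ₚ q) (0ℚ ∷ cs *ₚ q) x ⟩
    evalP (c ·ₚ q) x + (0ℚ + x * evalP (cs *ₚ q) x)
      ≡⟨ cong₂ (λ u v → u + (0ℚ + x * v)) (eval-·ₚ c q x) (eval-*ₚ cs q x) ⟩
    c * evalP q x + (0ℚ + x * (evalP cs x * evalP q x))
      ≡⟨ solve 4 (λ c x u v → c :* v :+ (con 0ℚ :+ x :* (u :* v)) := (c :+ x :* u) :* v)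
               refl c x (evalP cs x) (evalP q x) ⟩
    (c + x * evalP cs x) * evalP q x ∎

eval-const : ∀ c x → evalP (c ∷ []) x ≡ c
eval-const c x = trans (cong (λ z → c + z) (ℚP.*-zeroʳ x)) (ℚP.+-identityʳ c)

eval-^ₚ : ∀ p k x → evalP (p ^ₚ k) x ≡ evalP p x ^ℚ k
eval-^ₚ p zero    x = eval-const 1ℚ x
eval-^ₚ p (suc k) x = trans (eval-*ₚ p (p ^ₚ k) x) (cong (evalP p x *_) (eval-^ₚ p k x))

coeff-+ₚ : ∀ p q k → coeffℚ (p +ₚ q) k ≡ coeffℚ p k + coeffℚ q k
coeff-+ₚ []      q       k       = sym (ℚP.+-identityˡ _)
coeff-+ₚ (a ∷ p) []      k       = sym (ℚP.+-identityʳ _)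
coeff-+ₚ (a ∷ p) (b ∷ q) zero    = refl
coeff-+ₚ (a ∷ p) (b ∷ q) (suc k) = coeff-+ₚ p q k

coeff-·ₚ : ∀ c p k → coeffℚ (c ·ₚ p) k ≡ c * coeffℚ p k
coeff-·ₚ c []      k       = sym (ℚP.*-zeroʳ c)
coeff-·ₚ c (a ∷ p) zero    = refl
coeff-·ₚ c (a ∷ p) (suc k) = coeff-·ₚ c p k

coeff-*ₚ-zero : ∀ c cs q → coeffℚ ((c ∷ cs) *ₚ q) zero ≡ c * coeffℚ q zero
coeff-*ₚ-zero c cs q = trans (coeff-+ₚ (c ·ₚ q) (0ℚ ∷ cs *ₚ q) zero)
                             (trans (ℚP.+-identityʳ _) (coeff-·ₚ c q zero))

coeff-*ₚ-suc : ∀ c cs q k →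
  coeffℚ ((c ∷ cs) *ₚ q) (suc k) ≡ c * coeffℚ q (suc k) + coeffℚ (cs *ₚ q) k
coeff-*ₚ-suc c cs q k = trans (coeff-+ₚ (c ·ₚ q) (0ℚ ∷ cs *ₚ q) (suc k))
                              (cong (_+ coeffℚ (cs *ₚ q) k) (coeff-·ₚ c q (suc k)))

length-+ₚ : ∀ p q → length (p +ₚ q) ≡ length p ℕ.⊔ length q
length-+ₚ []      q       = refl
length-+ₚ (a ∷ p) []      = refl
length-+ₚ (a ∷ p) (b ∷ q) = cong suc (length-+ₚ p q)

-- Polynomials with the same values have the same coefficients: apply the
-- identity theorem to the difference p − q.
coeffs-unique : ∀ p q → (∀ x → evalP p x ≡ evalP q x) → ∀ k → coeffℚ p k ≡ coeffℚ q k
coeffs-unique p q p≗q k = x-y≡0⇒x≡y _ _ (begin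
    coeffℚ p k - coeffℚ q k
      ≡⟨ solve 2 (λ a b → a :- b := a :+ (:- con 1ℚ) :* b) refl (coeffℚ p k) (coeffℚ q k) ⟩
    coeffℚ p k + (- 1ℚ) * coeffℚ q k
      ≡⟨ cong (λ z → coeffℚ p k + z) (sym (coeff-·ₚ (- 1ℚ) q k)) ⟩
    coeffℚ p k + coeffℚ ((- 1ℚ) ·ₚ q) k
      ≡⟨ sym (coeff-+ₚ p ((- 1ℚ) ·ₚ q) k) ⟩
    coeffℚ (p +ₚ (- 1ℚ) ·ₚ q) k
      ≡⟨ vanishing⇒zeroCoeffs (p +ₚ (- 1ℚ) ·ₚ q) difference≡0 k ⟩
    0ℚ ∎)
  where
  difference≡0 : ∀ x → evalP (p +ₚ (- 1ℚ) ·ₚ q) x ≡ 0ℚ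
  difference≡0 x = begin
    evalP (p +ₚ (- 1ℚ) ·ₚ q) x           ≡⟨ eval-+ₚ p _ x ⟩
    evalP p x + evalP ((- 1ℚ) ·ₚ q) x    ≡⟨ cong₂ _+_ (p≗q x) (eval-·ₚ (- 1ℚ) q x) ⟩
    evalP q x + (- 1ℚ) * evalP q x       ≡⟨ solve 1 (λ v → v :+ (:- con 1ℚ) :* v := con 0ℚ) refl (evalP q x) ⟩
    0ℚ                                   ∎

VanishesFrom : ℕ → Poly → Set
VanishesFrom N p = ∀ j → N ℕ.≤ j → coeffℚ p j ≡ 0ℚ

VanishesFrom-length : ∀ p → VanishesFrom (length p) p
VanishesFrom-length []       j       _         = refl
VanishesFrom-length (c ∷ cs) (suc j) (s≤s len≤j) = VanishesFrom-length cs j len≤j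

leading : ∀ q → (∀ k → coeffℚ q k ≡ 0ℚ) ⊎ Σ[ e ∈ ℕ ] (coeffℚ q e ≢ 0ℚ × VanishesFrom (suc e) q)
leading []       = inj₁ (λ k → refl)
leading (c ∷ cs) with leading cs
... | inj₂ (e , lead≢0 , cs-deg) = inj₂ (suc e , lead≢0 , λ { (suc j) (s≤s e<j) → cs-deg j e<j })
... | inj₁ cs≡0 with c ℚP.≟ 0ℚ
...   | yes c≡0 = inj₁ (λ { zero → c≡0 ; (suc k) → cs≡0 k })
...   | no  c≢0 = inj₂ (0 , c≢0 , λ { (suc j) _ → cs≡0 j })

zeroCoeffs-*ₚ : ∀ p q → (∀ k → coeffℚ p k ≡ 0ℚ) → ∀ k → coeffℚ (p *ₚ q) k ≡ 0ℚ
zeroCoeffs-*ₚ p q p≡0 = vanishing⇒zeroCoeffs (p *ₚ q) λ x → begin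
    evalP (p *ₚ q) x       ≡⟨ eval-*ₚ p q x ⟩
    evalP p x * evalP q x  ≡⟨ cong (_* evalP q x) (zeroCoeffs⇒vanishing p p≡0 x) ⟩
    0ℚ * evalP q x         ≡⟨ ℚP.*-zeroˡ (evalP q x) ⟩
    0ℚ                     ∎

leadingCoeff-*ₚ : ∀ p q d e → VanishesFrom (suc d) p → VanishesFrom (suc e) q →
                  coeffℚ (p *ₚ q) (d ℕ.+ e) ≡ coeffℚ p d * coeffℚ q e
leadingCoeff-*ₚ []       q d       e p-deg q-deg = sym (ℚP.*-zeroˡ (coeffℚ q e))
leadingCoeff-*ₚ (c ∷ cs) q zero    e p-deg q-deg = begin
    coeffℚ (c ·ₚ q +ₚ (0ℚ ∷ cs *ₚ q)) e
      ≡⟨ coeff-+ₚ (c ·ₚ q) (0ℚ ∷ cs *ₚ q) e ⟩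
    coeffℚ (c ·ₚ q) e + coeffℚ (0ℚ ∷ cs *ₚ q) e
      ≡⟨ cong₂ _+_ (coeff-·ₚ c q e) (shifted≡0 e) ⟩
    c * coeffℚ q e + 0ℚ
      ≡⟨ ℚP.+-identityʳ _ ⟩
    c * coeffℚ q e ∎
  where
  shifted≡0 : ∀ e → coeffℚ (0ℚ ∷ cs *ₚ q) e ≡ 0ℚ
  shifted≡0 zero    = refl
  shifted≡0 (suc e) = zeroCoeffs-*ₚ cs q (λ j → p-deg (suc j) (s≤s z≤n)) e
leadingCoeff-*ₚ (c ∷ cs) q (suc d) e p-deg q-deg = begin
    coeffℚ ((c ∷ cs) *ₚ q) (suc (d ℕ.+ e))
      ≡⟨ coeff-*ₚ-suc c cs q (d ℕ.+ e) ⟩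
    c * coeffℚ q (suc (d ℕ.+ e)) + coeffℚ (cs *ₚ q) (d ℕ.+ e)
      ≡⟨ cong₂ (λ u v → c * u + v) (q-deg _ (s≤s (ℕP.m≤n+m e d)))
               (leadingCoeff-*ₚ cs q d e (λ j d<j → p-deg (suc j) (s≤s d<j)) q-deg) ⟩
    c * 0ℚ + coeffℚ cs d * coeffℚ q e
      ≡⟨ cong (_+ coeffℚ cs d * coeffℚ q e) (ℚP.*-zeroʳ c) ⟩
    0ℚ + coeffℚ cs d * coeffℚ q e
      ≡⟨ ℚP.+-identityˡ _ ⟩
    coeffℚ cs d * coeffℚ q e ∎

-- A polynomial dividing a nonzero constant has degree 0: otherwise the top
-- coefficient of p·q would sit in positive degree, where a constant has none.
divides-constant⇒degree0 : ∀ p d q κ → coeffℚ p d ≢ 0ℚ → VanishesFrom (suc d) p → κ ≢ 0ℚ →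
                           (∀ x → evalP p x * evalP q x ≡ κ) → d ≡ 0
divides-constant⇒degree0 p zero    q κ _ _ _ _ = refl
divides-constant⇒degree0 p (suc d) q κ lead≢0 p-deg κ≢0 pq≡κ with leading q
... | inj₁ q≡0 = contradiction (begin
        κ                        ≡⟨ sym (pq≡κ 0ℚ) ⟩
        evalP p 0ℚ * evalP q 0ℚ  ≡⟨ cong (evalP p 0ℚ *_) (zeroCoeffs⇒vanishing q q≡0 0ℚ) ⟩
        evalP p 0ℚ * 0ℚ          ≡⟨ ℚP.*-zeroʳ (evalP p 0ℚ) ⟩
        0ℚ                       ∎) κ≢0
... | inj₂ (e , qe≢0 , q-deg) = contradiction (begin
        coeffℚ p (suc d) * coeffℚ q e  ≡⟨ sym (leadingCoeff-*ₚ p q (suc d) e p-deg q-deg) ⟩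
        coeffℚ (p *ₚ q) (suc d ℕ.+ e)  ≡⟨ coeffs-unique (p *ₚ q) (κ ∷ []) pq≗κ (suc d ℕ.+ e) ⟩
        coeffℚ (κ ∷ []) (suc d ℕ.+ e)  ≡⟨⟩
        0ℚ                             ∎) (*-nonZero lead≢0 qe≢0)
  where
  pq≗κ : ∀ x → evalP (p *ₚ q) x ≡ evalP (κ ∷ []) x
  pq≗κ x = trans (eval-*ₚ p q x) (trans (pq≡κ x) (sym (eval-const κ x)))

record Division (P Q : Poly) (e : ℕ) : Set where
  field
    quotient remainder : Poly
    remainder-small    : VanishesFrom e remainder
    division-eq        : ∀ x → evalP P x ≡ evalP quotient x * evalP Q x + evalP remainder x

eliminateLeading : ∀ Q R e α → VanishesFrom (suc e) Q → VanishesFrom (suc e) R →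
                   α * coeffℚ Q e ≡ coeffℚ R e → VanishesFrom e (R +ₚ (- α) ·ₚ Q)
eliminateLeading Q R e α Q-deg R-deg αℓ≡τ j e≤j = begin
    coeffℚ (R +ₚ (- α) ·ₚ Q) j          ≡⟨ coeff-+ₚ R ((- α) ·ₚ Q) j ⟩
    coeffℚ R j + coeffℚ ((- α) ·ₚ Q) j  ≡⟨ cong (λ z → coeffℚ R j + z) (coeff-·ₚ (- α) Q j) ⟩
    coeffℚ R j + (- α) * coeffℚ Q j     ≡⟨ top (ℕP.m≤n⇒m<n∨m≡n e≤j) ⟩
    0ℚ                                  ∎
  where
  top : e ℕ.< j ⊎ e ≡ j → coeffℚ R j + (- α) * coeffℚ Q j ≡ 0ℚ
  top (inj₁ e<j) = begin
    coeffℚ R j + (- α) * coeffℚ Q j  ≡⟨ cong₂ (λ u v → u + (- α) * v) (R-deg j e<j) (Q-deg j e<j) ⟩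
    0ℚ + (- α) * 0ℚ                  ≡⟨ solve 1 (λ a → con 0ℚ :+ a :* con 0ℚ := con 0ℚ) refl (- α) ⟩
    0ℚ                               ∎
  top (inj₂ refl) = begin
    coeffℚ R e + (- α) * coeffℚ Q e  ≡⟨ cong (_+ (- α) * coeffℚ Q e) (sym αℓ≡τ) ⟩
    α * coeffℚ Q e + (- α) * coeffℚ Q e
      ≡⟨ solve 2 (λ a l → a :* l :+ (:- a) :* l := con 0ℚ) refl α (coeffℚ Q e) ⟩
    0ℚ                               ∎

-- Long division, by induction on the dividend: from P = S·Q + R one gets
-- c + x·P = (x·S + α)·Q + ((c + x·R) − α·Q).
divide : ∀ Q e → coeffℚ Q e ≢ 0ℚ → VanishesFrom (suc e) Q → ∀ P → Division P Q e
divide Q e lead≢0 Q-deg [] = record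
  { quotient = [] ; remainder = [] ; remainder-small = λ _ _ → refl
  ; division-eq = λ x → sym (trans (ℚP.+-identityʳ _) (ℚP.*-zeroˡ (evalP Q x))) }
divide Q e lead≢0 Q-deg (c ∷ P) = record
  { quotient        = (0ℚ ∷ S) +ₚ (α ∷ [])
  ; remainder       = (c ∷ R) +ₚ (- α) ·ₚ Q
  ; remainder-small = eliminateLeading Q (c ∷ R) e α Q-deg shifted-deg αℓ≡τ
  ; division-eq     = eq
  }
  where
  open Division (divide Q e lead≢0 Q-deg P)
    renaming (quotient to S; remainder to R; remainder-small to R-small; division-eq to P≡SQ+R)
  α : ℚ
  α = proj₁ (divides lead≢0 (coeffℚ (c ∷ R) e))
  αℓ≡τ : α * coeffℚ Q e ≡ coeffℚ (c ∷ R) e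
  αℓ≡τ = proj₂ (divides lead≢0 (coeffℚ (c ∷ R) e))
  shifted-deg : VanishesFrom (suc e) (c ∷ R)
  shifted-deg (suc j) (s≤s e≤j) = R-small j e≤j
  eq : ∀ x → evalP (c ∷ P) x ≡ evalP ((0ℚ ∷ S) +ₚ (α ∷ [])) x * evalP Q x
                                + evalP ((c ∷ R) +ₚ (- α) ·ₚ Q) x
  eq x = begin
      c + x * evalP P x
        ≡⟨ cong (λ v → c + x * v) (P≡SQ+R x) ⟩
      c + x * (s * q + r)
        ≡⟨ solve 6 (λ c x s q r a → c :+ x :* (s :* q :+ r)
                     := ((con 0ℚ :+ x :* s) :+ (a :+ x :* con 0ℚ)) :* q :+ ((c :+ x :* r) :+ (:- a) :* q))
                 refl c x s q r α ⟩
      ((0ℚ + x * s) + (α + x * 0ℚ)) * q + ((c + x * r) + (- α) * q)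
        ≡⟨ sym (cong₂ (λ u v → u * q + v) (eval-+ₚ (0ℚ ∷ S) (α ∷ []) x)
                  (trans (eval-+ₚ (c ∷ R) ((- α) ·ₚ Q) x) (cong (λ v → (c + x * r) + v) (eval-·ₚ (- α) Q x)))) ⟩
      evalP ((0ℚ ∷ S) +ₚ (α ∷ [])) x * q + evalP ((c ∷ R) +ₚ (- α) ·ₚ Q) x ∎
    where
    s = evalP S x
    q = evalP Q x
    r = evalP R x

record BezoutGcd (P Q : Poly) : Set where
  field
    gcd u v P/gcd Q/gcd : Poly
    gcd-divides-P : ∀ x → evalP P x ≡ evalP gcd x * evalP P/gcd x
    gcd-divides-Q : ∀ x → evalP Q x ≡ evalP gcd x * evalP Q/gcd x
    bezout        : ∀ x → evalP gcd x ≡ evalP u x * evalP P x + evalP v x * evalP Q x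

bezoutGcd-zero : ∀ P Q → (∀ k → coeffℚ Q k ≡ 0ℚ) → BezoutGcd P Q
bezoutGcd-zero P Q Q≡0 = record
  { gcd = P ; u = 1ℚ ∷ [] ; v = [] ; P/gcd = 1ℚ ∷ [] ; Q/gcd = []
  ; gcd-divides-P = λ x → solve 2 (λ p x → p := p :* (con 1ℚ :+ x :* con 0ℚ)) refl (evalP P x) x
  ; gcd-divides-Q = λ x → trans (zeroCoeffs⇒vanishing Q Q≡0 x) (sym (ℚP.*-zeroʳ (evalP P x)))
  ; bezout = λ x → solve 3 (λ p q x → p := (con 1ℚ :+ x :* con 0ℚ) :* p :+ con 0ℚ :* q)
                         refl (evalP P x) (evalP Q x) x
  }

bezoutGcd-step : ∀ {P Q e} (D : Division P Q e) → BezoutGcd Q (Division.remainder D) → BezoutGcd P Q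
bezoutGcd-step {P} {Q} D G = record
  { gcd = gcd ; u = v ; v = u +ₚ (- 1ℚ) ·ₚ (v *ₚ S)
  ; P/gcd = S *ₚ Q/gcd +ₚ R/gcd ; Q/gcd = Q/gcd
  ; gcd-divides-P = divides-P ; gcd-divides-Q = gcd-divides-Q ; bezout = bezout′ }
  where
  open Division D renaming (quotient to S; remainder to R)
  open BezoutGcd G renaming (P/gcd to Q/gcd; Q/gcd to R/gcd; gcd-divides-P to gcd-divides-Q;
                              gcd-divides-Q to gcd-divides-R)
  divides-P : ∀ x → evalP P x ≡ evalP gcd x * evalP (S *ₚ Q/gcd +ₚ R/gcd) x
  divides-P x = begin
      evalP P x                              ≡⟨ division-eq x ⟩
      s * evalP Q x + evalP R x              ≡⟨ cong₂ (λ a b → s * a + b) (gcd-divides-Q x) (gcd-divides-R x) ⟩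
      s * (d * a) + d * b                    ≡⟨ solve 4 (λ s d a b → s :* (d :* a) :+ d :* b := d :* (s :* a :+ b))
                                                      refl s d a b ⟩
      d * (s * a + b)                        ≡⟨ cong (d *_) (sym (trans (eval-+ₚ (S *ₚ Q/gcd) R/gcd x)
                                                                    (cong (_+ b) (eval-*ₚ S Q/gcd x)))) ⟩
      d * evalP (S *ₚ Q/gcd +ₚ R/gcd) x      ∎
    where
    s = evalP S x
    d = evalP gcd x
    a = evalP Q/gcd x
    b = evalP R/gcd x
  bezout′ : ∀ x → evalP gcd x ≡ evalP v x * evalP P x + evalP (u +ₚ (- 1ℚ) ·ₚ (v *ₚ S)) x * evalP Q x
  bezout′ x = begin
      evalP gcd x                       ≡⟨ bezout x ⟩
      ux * q + vx * r                   ≡⟨ solve 5 (λ u v q r s → u :* q :+ v :* r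
                                                     := v :* (s :* q :+ r) :+ (u :+ (:- con 1ℚ) :* (v :* s)) :* q)
                                                 refl ux vx q r s ⟩
      vx * (s * q + r) + (ux + (- 1ℚ) * (vx * s)) * q
        ≡⟨ sym (cong₂ (λ a b → vx * a + b * q) (division-eq x)
                  (trans (eval-+ₚ u _ x) (cong (λ z → ux + z) (trans (eval-·ₚ (- 1ℚ) (v *ₚ S) x)
                                                               (cong ((- 1ℚ) *_) (eval-*ₚ v S x)))))) ⟩
      vx * evalP P x + evalP (u +ₚ (- 1ℚ) ·ₚ (v *ₚ S)) x * q ∎
    where
    ux = evalP u x
    vx = evalP v x
    q = evalP Q x
    r = evalP R x
    s = evalP S x

-- Euclid's algorithm, with fuel N bounding the length of the divisor.
euclid : ∀ N P Q → VanishesFrom N Q → BezoutGcd P Q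
euclid zero    P Q Q-small = bezoutGcd-zero P Q (λ k → Q-small k z≤n)
euclid (suc N) P Q Q-small with leading Q
... | inj₁ Q≡0 = bezoutGcd-zero P Q Q≡0
... | inj₂ (e , lead≢0 , Q-deg) with e ℕ.≤? N
...   | no  e≰N = contradiction (Q-small e (ℕP.≰⇒> e≰N)) lead≢0
...   | yes e≤N = bezoutGcd-step D
                    (euclid N Q (Division.remainder D)
                       (λ j N≤j → Division.remainder-small D j (ℕP.≤-trans e≤N N≤j)))
  where D = divide Q e lead≢0 Q-deg P

eval≡evalP : ∀ f x → eval f x ≡ evalP (toℚ[t] f) x
eval≡evalP []       x = refl
eval≡evalP (c ∷ cs) x = cong (λ v → fromℤ c + x * v) (eval≡evalP cs x)

coeff-toℚ : ∀ f k → coeffℚ (toℚ[t] f) k ≡ fromℤ (coeffℤ f k)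
coeff-toℚ []       k       = refl
coeff-toℚ (c ∷ cs) zero    = refl
coeff-toℚ (c ∷ cs) (suc k) = coeff-toℚ cs k

module _ (f : List ℤ) {r : ℕ} (f-deg : HasDegree f r) where

  hasDegree-lead : coeffℚ (toℚ[t] f) r ≢ 0ℚ
  hasDegree-lead lead≡0 = proj₁ f-deg (fromℤ-injective (trans (sym (coeff-toℚ f r)) lead≡0))

  hasDegree-vanishesFrom : VanishesFrom (suc r) (toℚ[t] f)
  hasDegree-vanishesFrom j r<j = trans (coeff-toℚ f j) (cong fromℤ (proj₂ f-deg j r<j))

  hasDegree-nonvanishing : ¬ (∀ x → evalP (toℚ[t] f) x ≡ 0ℚ)
  hasDegree-nonvanishing f≡0 = hasDegree-lead (vanishing⇒zeroCoeffs (toℚ[t] f) f≡0 r)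

sumUpTo-zero : ∀ h k → (∀ i → h i ≡ 0ℚ) → sumUpTo h k ≡ 0ℚ
sumUpTo-zero h zero    h≡0 = h≡0 0
sumUpTo-zero h (suc k) h≡0 = cong₂ _+_ (sumUpTo-zero h k h≡0) (h≡0 (suc k))

sumUpTo-shift : ∀ h k → sumUpTo h (suc k) ≡ h 0 + sumUpTo (λ i → h (suc i)) k
sumUpTo-shift h zero    = refl
sumUpTo-shift h (suc k) = trans (cong (_+ h (suc (suc k))) (sumUpTo-shift h k)) (ℚP.+-assoc (h 0) _ _)

coeff-*ₚ : ∀ h q k → coeffℚ (h *ₚ q) k ≡ mulCoeff h q k
coeff-*ₚ []       q k       = sym (sumUpTo-zero _ k (λ i → ℚP.*-zeroˡ (coeffℚ q (k ℕ.∸ i))))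
coeff-*ₚ (c ∷ cs) q zero    = coeff-*ₚ-zero c cs q
coeff-*ₚ (c ∷ cs) q (suc k) = begin
    coeffℚ ((c ∷ cs) *ₚ q) (suc k)             ≡⟨ coeff-*ₚ-suc c cs q k ⟩
    c * coeffℚ q (suc k) + coeffℚ (cs *ₚ q) k  ≡⟨ cong (λ v → c * coeffℚ q (suc k) + v) (coeff-*ₚ cs q k) ⟩
    c * coeffℚ q (suc k) + mulCoeff cs q k     ≡⟨ sym (sumUpTo-shift (λ i → coeffℚ (c ∷ cs) i * coeffℚ q (suc k ℕ.∸ i)) k) ⟩
    mulCoeff (c ∷ cs) q (suc k)                ∎

pointwise⇒divides : ∀ h p q → (∀ x → evalP p x ≡ evalP h x * evalP q x) → h ∣ℚ[t] p
pointwise⇒divides h p q p≡hq = q , λ k →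
  trans (coeffs-unique p (h *ₚ q) (λ x → trans (p≡hq x) (sym (eval-*ₚ h q x))) k) (coeff-*ₚ h q k)

constant-eval : ∀ p → (∀ k → coeffℚ p (suc k) ≡ 0ℚ) → ∀ x → evalP p x ≡ coeffℚ p 0
constant-eval []       _   x = refl
constant-eval (c ∷ cs) cs≡0 x = begin
    c + x * evalP cs x  ≡⟨ cong (λ v → c + x * v) (zeroCoeffs⇒vanishing cs cs≡0 x) ⟩
    c + x * 0ℚ          ≡⟨ eval-const c x ⟩
    c                   ∎

record UnitBezout (F G : Poly) : Set where
  field
    unit     : ℚ
    unit≢0   : unit ≢ 0ℚ
    u v      : Poly
    bezout   : ∀ x → unit ≡ evalP u x * evalP F x + evalP v x * evalP G x

coprime⇒unitBezout : ∀ f g {r} → HasDegree f r → CoprimeInℚ[t] f g → UnitBezout (toℚ[t] f) (toℚ[t] g)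
coprime⇒unitBezout f g f-deg coprime = record
  { unit = d₀ ; unit≢0 = d₀≢0 ; u = u ; v = v
  ; bezout = λ x → trans (sym (d-const x)) (bezout x) }
  where
  F = toℚ[t] f
  G = toℚ[t] g
  open BezoutGcd (euclid (length G) F G (VanishesFrom-length G))
  d₀ : ℚ
  d₀ = coeffℚ gcd 0
  d-const : ∀ x → evalP gcd x ≡ d₀
  d-const = constant-eval gcd (λ k → coprime gcd (pointwise⇒divides gcd F P/gcd gcd-divides-P)
                                                 (pointwise⇒divides gcd G Q/gcd gcd-divides-Q) (suc k) (s≤s z≤n))
  -- a zero gcd would make F, a multiple of it, the zero function
  d₀≢0 : d₀ ≢ 0ℚ
  d₀≢0 d₀≡0 = hasDegree-nonvanishing f f-deg λ x → begin
      evalP F x                       ≡⟨ gcd-divides-P x ⟩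
      evalP gcd x * evalP P/gcd x     ≡⟨ cong (_* evalP P/gcd x) (trans (d-const x) d₀≡0) ⟩
      0ℚ * evalP P/gcd x              ≡⟨ ℚP.*-zeroˡ (evalP P/gcd x) ⟩
      0ℚ                              ∎

infixl 6 _‵+_
infixl 7 _‵*_
infix  8 _‵^_

data PolyExpr : Set where
  ‵poly     : Poly → PolyExpr
  ‵const    : ℚ → PolyExpr
  _‵+_ _‵*_ : PolyExpr → PolyExpr → PolyExpr
  _‵^_      : PolyExpr → ℕ → PolyExpr

⟦_⟧ : PolyExpr → ℚ → ℚ
⟦ ‵poly p  ⟧ x = evalP p x
⟦ ‵const c ⟧ x = c
⟦ a ‵+ b   ⟧ x = ⟦ a ⟧ x + ⟦ b ⟧ x
⟦ a ‵* b   ⟧ x = ⟦ a ⟧ x * ⟦ b ⟧ x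
⟦ a ‵^ k   ⟧ x = ⟦ a ⟧ x ^ℚ k

toPoly : PolyExpr → Poly
toPoly (‵poly p)  = p
toPoly (‵const c) = c ∷ []
toPoly (a ‵+ b)   = toPoly a +ₚ toPoly b
toPoly (a ‵* b)   = toPoly a *ₚ toPoly b
toPoly (a ‵^ k)   = toPoly a ^ₚ k

toPoly-eval : ∀ e x → evalP (toPoly e) x ≡ ⟦ e ⟧ x
toPoly-eval (‵poly p)  x = refl
toPoly-eval (‵const c) x = eval-const c x
toPoly-eval (a ‵+ b)   x = trans (eval-+ₚ (toPoly a) (toPoly b) x) (cong₂ _+_ (toPoly-eval a x) (toPoly-eval b x))
toPoly-eval (a ‵* b)   x = trans (eval-*ₚ (toPoly a) (toPoly b) x) (cong₂ _*_ (toPoly-eval a x) (toPoly-eval b x))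
toPoly-eval (a ‵^ k)   x = trans (eval-^ₚ (toPoly a) k x) (cong (_^ℚ k) (toPoly-eval a x))

five ten : ℚ
five = + 5 ℚ./ 1
ten  = + 10 ℚ./ 1

-- Cofactors in (uF + vG)⁵ = F³·X + G³·Y: with a = uF, b = vG the binomial
-- terms aⁱb⁵⁻ⁱ with i ≥ 3 carry u³F³, the others v³G³.
cofactorF cofactorG : (u v F G : ℚ) → ℚ
cofactorF u v F G = u ^ℚ 3 * ((u * F) ^ℚ 2 + five * ((u * F) * (v * G)) + ten * (v * G) ^ℚ 2)
cofactorG u v F G = v ^ℚ 3 * (ten * (u * F) ^ℚ 2 + five * ((u * F) * (v * G)) + (v * G) ^ℚ 2)

fifthPower-split : ∀ u v F G →
  (u * F + v * G) ^ℚ 5 ≡ F ^ℚ 3 * cofactorF u v F G + G ^ℚ 3 * cofactorG u v F G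
fifthPower-split = solve 4 (λ u v F G →
  (u :* F :+ v :* G) :^ 5
    := F :^ 3 :* (u :^ 3 :* ((u :* F) :^ 2 :+ con five :* ((u :* F) :* (v :* G)) :+ con ten :* (v :* G) :^ 2))
       :+ G :^ 3 :* (v :^ 3 :* (con ten :* (u :* F) :^ 2 :+ con five :* ((u :* F) :* (v :* G)) :+ (v :* G) :^ 2)))
  refl

-- The common cofactor W = A³X + B²GY of the two factorisations below.
weight : (A B u v F G : ℚ) → ℚ
weight A B u v F G = A ^ℚ 3 * cofactorF u v F G + B ^ℚ 2 * (G * cofactorG u v F G)

relation⇒G²-factor : ∀ A B u v F G → B ^ℚ 2 * F ^ℚ 3 ≡ A ^ℚ 3 * G ^ℚ 2 →
                     G ^ℚ 2 * weight A B u v F G ≡ B ^ℚ 2 * (u * F + v * G) ^ℚ 5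
relation⇒G²-factor A B u v F G relation = sym (begin
    B ^ℚ 2 * (u * F + v * G) ^ℚ 5
      ≡⟨ cong (B ^ℚ 2 *_) (fifthPower-split u v F G) ⟩
    B ^ℚ 2 * (F ^ℚ 3 * X + G ^ℚ 3 * Y)
      ≡⟨ solve 5 (λ B F G X Y → B :^ 2 :* (F :^ 3 :* X :+ G :^ 3 :* Y)
                   := (B :^ 2 :* F :^ 3) :* X :+ G :^ 2 :* (B :^ 2 :* (G :* Y))) refl B F G X Y ⟩
    (B ^ℚ 2 * F ^ℚ 3) * X + G ^ℚ 2 * (B ^ℚ 2 * (G * Y))
      ≡⟨ cong (λ z → z * X + G ^ℚ 2 * (B ^ℚ 2 * (G * Y))) relation ⟩
    (A ^ℚ 3 * G ^ℚ 2) * X + G ^ℚ 2 * (B ^ℚ 2 * (G * Y))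
      ≡⟨ solve 5 (λ A B G X Y → (A :^ 3 :* G :^ 2) :* X :+ G :^ 2 :* (B :^ 2 :* (G :* Y))
                   := G :^ 2 :* (A :^ 3 :* X :+ B :^ 2 :* (G :* Y))) refl A B G X Y ⟩
    G ^ℚ 2 * weight A B u v F G ∎)
  where
  X = cofactorF u v F G
  Y = cofactorG u v F G

relation⇒F³-factor : ∀ A B u v F G → B ^ℚ 2 * F ^ℚ 3 ≡ A ^ℚ 3 * G ^ℚ 2 →
                     F ^ℚ 3 * weight A B u v F G ≡ A ^ℚ 3 * (u * F + v * G) ^ℚ 5
relation⇒F³-factor A B u v F G relation = sym (begin
    A ^ℚ 3 * (u * F + v * G) ^ℚ 5
      ≡⟨ cong (A ^ℚ 3 *_) (fifthPower-split u v F G) ⟩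
    A ^ℚ 3 * (F ^ℚ 3 * X + G ^ℚ 3 * Y)
      ≡⟨ solve 5 (λ A F G X Y → A :^ 3 :* (F :^ 3 :* X :+ G :^ 3 :* Y)
                   := F :^ 3 :* (A :^ 3 :* X) :+ (A :^ 3 :* G :^ 2) :* (G :* Y)) refl A F G X Y ⟩
    F ^ℚ 3 * (A ^ℚ 3 * X) + (A ^ℚ 3 * G ^ℚ 2) * (G * Y)
      ≡⟨ cong (λ z → F ^ℚ 3 * (A ^ℚ 3 * X) + z * (G * Y)) (sym relation) ⟩
    F ^ℚ 3 * (A ^ℚ 3 * X) + (B ^ℚ 2 * F ^ℚ 3) * (G * Y)
      ≡⟨ solve 5 (λ B F G X' Y → F :^ 3 :* X' :+ (B :^ 2 :* F :^ 3) :* (G :* Y)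
                   := F :^ 3 :* (X' :+ B :^ 2 :* (G :* Y))) refl B F G (A ^ℚ 3 * X) Y ⟩
    F ^ℚ 3 * weight A B u v F G ∎)
  where
  X = cofactorF u v F G
  Y = cofactorG u v F G

weightExpr : (A B : ℚ) (u v F G : PolyExpr) → PolyExpr
weightExpr A B u v F G =
  ‵const (A ^ℚ 3) ‵* (u ‵^ 3 ‵* ((u ‵* F) ‵^ 2 ‵+ ‵const five ‵* ((u ‵* F) ‵* (v ‵* G))
                                 ‵+ ‵const ten ‵* (v ‵* G) ‵^ 2))
  ‵+ ‵const (B ^ℚ 2) ‵* (G ‵* (v ‵^ 3 ‵* (‵const ten ‵* (u ‵* F) ‵^ 2
                                         ‵+ ‵const five ‵* ((u ‵* F) ‵* (v ‵* G)) ‵+ (v ‵* G) ‵^ 2)))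

noPositiveDegree : ∀ {r s} → r ≡ 0 → s ≡ 0 → ¬ (0 ℕ.< r ⊎ 0 ℕ.< s)
noPositiveDegree refl refl (inj₁ ())
noPositiveDegree refl refl (inj₂ ())

module WeightedRelation (f g : List ℤ) {r s : ℕ} (f-deg : HasDegree f r) (g-deg : HasDegree g s)
                        (coprime : CoprimeInℚ[t] f g) (A B : ℚ)
                        (relation : ∀ x → B ^ℚ 2 * evalP (toℚ[t] f) x ^ℚ 3 ≡ A ^ℚ 3 * evalP (toℚ[t] g) x ^ℚ 2)
                        where
  private
    F G : Poly
    F = toℚ[t] f
    G = toℚ[t] g
  open UnitBezout (coprime⇒unitBezout f g f-deg coprime)

  W : Poly
  W = toPoly (weightExpr A B (‵poly u) (‵poly v) (‵poly F) (‵poly G))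

  W-eval : ∀ x → evalP W x ≡ weight A B (evalP u x) (evalP v x) (evalP F x) (evalP G x)
  W-eval = toPoly-eval (weightExpr A B (‵poly u) (‵poly v) (‵poly F) (‵poly G))

  power-times-W : ∀ p k c → (∀ x → evalP p x ^ℚ suc k * evalP W x ≡ c) →
                  ∀ x → evalP p x * evalP (p ^ₚ k *ₚ W) x ≡ c
  power-times-W p k c pW≡c x = begin
      evalP p x * evalP (p ^ₚ k *ₚ W) x         ≡⟨ cong (evalP p x *_) (eval-*ₚ (p ^ₚ k) W x) ⟩
      evalP p x * (evalP (p ^ₚ k) x * evalP W x) ≡⟨ cong (λ z → evalP p x * (z * evalP W x)) (eval-^ₚ p k x) ⟩
      evalP p x * (evalP p x ^ℚ k * evalP W x)  ≡⟨ sym (ℚP.*-assoc (evalP p x) _ _) ⟩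
      evalP p x ^ℚ suc k * evalP W x            ≡⟨ pW≡c x ⟩
      c                                         ∎

  A≢0⇒r≡0 : A ≢ 0ℚ → r ≡ 0
  A≢0⇒r≡0 A≢0 = divides-constant⇒degree0 F r (F ^ₚ 2 *ₚ W) (A ^ℚ 3 * unit ^ℚ 5)
    (hasDegree-lead f f-deg) (hasDegree-vanishesFrom f f-deg)
    (*-nonZero (^-nonZero 3 A≢0) (^-nonZero 5 unit≢0))
    (power-times-W F 2 _ λ x → begin
      evalP F x ^ℚ 3 * evalP W x   ≡⟨ cong (evalP F x ^ℚ 3 *_) (W-eval x) ⟩
      evalP F x ^ℚ 3 * weight A B (evalP u x) (evalP v x) (evalP F x) (evalP G x)
                                   ≡⟨ relation⇒F³-factor A B (evalP u x) (evalP v x) (evalP F x) (evalP G x) (relation x) ⟩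
      A ^ℚ 3 * (evalP u x * evalP F x + evalP v x * evalP G x) ^ℚ 5
                                   ≡⟨ cong (λ c → A ^ℚ 3 * c ^ℚ 5) (sym (bezout x)) ⟩
      A ^ℚ 3 * unit ^ℚ 5           ∎)

  B≢0⇒s≡0 : B ≢ 0ℚ → s ≡ 0
  B≢0⇒s≡0 B≢0 = divides-constant⇒degree0 G s (G ^ₚ 1 *ₚ W) (B ^ℚ 2 * unit ^ℚ 5)
    (hasDegree-lead g g-deg) (hasDegree-vanishesFrom g g-deg)
    (*-nonZero (^-nonZero 2 B≢0) (^-nonZero 5 unit≢0))
    (power-times-W G 1 _ λ x → begin
      evalP G x ^ℚ 2 * evalP W x   ≡⟨ cong (evalP G x ^ℚ 2 *_) (W-eval x) ⟩
      evalP G x ^ℚ 2 * weight A B (evalP u x) (evalP v x) (evalP F x) (evalP G x)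
                                   ≡⟨ relation⇒G²-factor A B (evalP u x) (evalP v x) (evalP F x) (evalP G x) (relation x) ⟩
      B ^ℚ 2 * (evalP u x * evalP F x + evalP v x * evalP G x) ^ℚ 5
                                   ≡⟨ cong (λ c → B ^ℚ 2 * c ^ℚ 5) (sym (bezout x)) ⟩
      B ^ℚ 2 * unit ^ℚ 5           ∎)

  -- With A = 0 the relation reads B²F³ = 0, so B = 0 since F is not the zero function.
  A≡0⇒B≡0 : A ≡ 0ℚ → B ≡ 0ℚ
  A≡0⇒B≡0 A≡0 with B ℚP.≟ 0ℚ
  ... | yes B≡0 = B≡0
  ... | no  B≢0 = contradiction F≡0 (hasDegree-nonvanishing f f-deg)
    where
    F≡0 : ∀ x → evalP F x ≡ 0ℚ
    F≡0 x = ^≡0⇒≡0 _ 3 (*≡0⇒≡0 (B ^ℚ 2) _ (begin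
      B ^ℚ 2 * evalP F x ^ℚ 3    ≡⟨ relation x ⟩
      A ^ℚ 3 * evalP G x ^ℚ 2    ≡⟨ cong (λ a → a ^ℚ 3 * evalP G x ^ℚ 2) A≡0 ⟩
      0ℚ ^ℚ 3 * evalP G x ^ℚ 2   ≡⟨ solve 1 (λ y → con 0ℚ :^ 3 :* y := con 0ℚ) refl (evalP G x ^ℚ 2) ⟩
      0ℚ                         ∎) (^-nonZero 2 B≢0))

  B≡0⇒A≡0 : B ≡ 0ℚ → A ≡ 0ℚ
  B≡0⇒A≡0 B≡0 with A ℚP.≟ 0ℚ
  ... | yes A≡0 = A≡0
  ... | no  A≢0 = contradiction G≡0 (hasDegree-nonvanishing g g-deg)
    where
    G≡0 : ∀ x → evalP G x ≡ 0ℚ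
    G≡0 x = ^≡0⇒≡0 _ 2 (*≡0⇒≡0 (A ^ℚ 3) _ (begin
      A ^ℚ 3 * evalP G x ^ℚ 2    ≡⟨ sym (relation x) ⟩
      B ^ℚ 2 * evalP F x ^ℚ 3    ≡⟨ cong (λ b → b ^ℚ 2 * evalP F x ^ℚ 3) B≡0 ⟩
      0ℚ ^ℚ 2 * evalP F x ^ℚ 3   ≡⟨ solve 1 (λ y → con 0ℚ :^ 2 :* y := con 0ℚ) refl (evalP F x ^ℚ 3) ⟩
      0ℚ                         ∎) (^-nonZero 3 A≢0))

  relation⇒trivial : (0 ℕ.< r ⊎ 0 ℕ.< s) → A ≡ 0ℚ × B ≡ 0ℚ
  relation⇒trivial positive with A ℚP.≟ 0ℚ | B ℚP.≟ 0ℚ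
  ... | yes A≡0 | _       = A≡0 , A≡0⇒B≡0 A≡0
  ... | no  A≢0 | yes B≡0 = contradiction (B≡0⇒A≡0 B≡0) A≢0
  ... | no  A≢0 | no  B≢0 = contradiction positive (noPositiveDegree (A≢0⇒r≡0 A≢0) (B≢0⇒s≡0 B≢0))

relationPoly : Poly → Poly → ℚ → ℚ → Poly
relationPoly F G A B = B ^ℚ 2 ·ₚ F ^ₚ 3 +ₚ (- A ^ℚ 3) ·ₚ G ^ₚ 2

relationPoly-eval : ∀ F G A B x →
  evalP (relationPoly F G A B) x ≡ B ^ℚ 2 * evalP F x ^ℚ 3 - A ^ℚ 3 * evalP G x ^ℚ 2
relationPoly-eval F G A B x = begin
    evalP (relationPoly F G A B) x
      ≡⟨ eval-+ₚ (B ^ℚ 2 ·ₚ F ^ₚ 3) ((- A ^ℚ 3) ·ₚ G ^ₚ 2) x ⟩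
    evalP (B ^ℚ 2 ·ₚ F ^ₚ 3) x + evalP ((- A ^ℚ 3) ·ₚ G ^ₚ 2) x
      ≡⟨ cong₂ _+_ (trans (eval-·ₚ (B ^ℚ 2) (F ^ₚ 3) x) (cong (B ^ℚ 2 *_) (eval-^ₚ F 3 x)))
                   (trans (eval-·ₚ (- A ^ℚ 3) (G ^ₚ 2) x) (cong ((- A ^ℚ 3) *_) (eval-^ₚ G 2 x))) ⟩
    B ^ℚ 2 * evalP F x ^ℚ 3 + (- A ^ℚ 3) * evalP G x ^ℚ 2
      ≡⟨ cong (λ z → B ^ℚ 2 * evalP F x ^ℚ 3 + z) (sym (ℚP.neg-distribˡ-* (A ^ℚ 3) (evalP G x ^ℚ 2))) ⟩
    B ^ℚ 2 * evalP F x ^ℚ 3 - A ^ℚ 3 * evalP G x ^ℚ 2 ∎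

relationPoly-length : ∀ F G A B → length (relationPoly F G A B) ≡ length (F ^ₚ 3) ℕ.⊔ length (G ^ₚ 2)
relationPoly-length F G A B = trans (length-+ₚ (B ^ℚ 2 ·ₚ F ^ₚ 3) ((- A ^ℚ 3) ·ₚ G ^ₚ 2))
  (cong₂ ℕ._⊔_ (ListP.length-map (B ^ℚ 2 *_) (F ^ₚ 3)) (ListP.length-map ((- A ^ℚ 3) *_) (G ^ₚ 2)))

^6n-square : ∀ x n → (x ^ℚ (6 ℕ.* n)) ^ℚ 2 ≡ (x ^ℚ (4 ℕ.* n)) ^ℚ 3
^6n-square x n = begin
    (x ^ℚ (6 ℕ.* n)) ^ℚ 2  ≡⟨ sym (^-* x (6 ℕ.* n) 2) ⟩
    x ^ℚ (6 ℕ.* n ℕ.* 2)   ≡⟨ cong (x ^ℚ_) exponents ⟩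
    x ^ℚ (4 ℕ.* n ℕ.* 3)   ≡⟨ ^-* x (4 ℕ.* n) 3 ⟩
    (x ^ℚ (4 ℕ.* n)) ^ℚ 3  ∎
  where
  exponents : 6 ℕ.* n ℕ.* 2 ≡ 4 ℕ.* n ℕ.* 3
  exponents = trans (ℕP.*-assoc 6 n 2) (trans (cong (6 ℕ.*_) (ℕP.*-comm n 2))
              (trans (sym (ℕP.*-assoc 6 2 n)) (trans (ℕP.*-assoc 4 3 n)
              (trans (cong (4 ℕ.*_) (ℕP.*-comm 3 n)) (sym (ℕP.*-assoc 4 n 3))))))

weightedValues-relation : ∀ β n F G →
  (β ^ℚ (6 ℕ.* n) * G) ^ℚ 2 * F ^ℚ 3 ≡ (β ^ℚ (4 ℕ.* n) * F) ^ℚ 3 * G ^ℚ 2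
weightedValues-relation β n F G = begin
    (q * G) ^ℚ 2 * F ^ℚ 3      ≡⟨ solve 3 (λ q F G → (q :* G) :^ 2 :* F :^ 3 := q :^ 2 :* (G :^ 2 :* F :^ 3)) refl q F G ⟩
    q ^ℚ 2 * (G ^ℚ 2 * F ^ℚ 3) ≡⟨ cong (_* (G ^ℚ 2 * F ^ℚ 3)) (^6n-square β n) ⟩
    p ^ℚ 3 * (G ^ℚ 2 * F ^ℚ 3) ≡⟨ solve 3 (λ p F G → p :^ 3 :* (G :^ 2 :* F :^ 3) := (p :* F) :^ 3 :* G :^ 2) refl p F G ⟩
    (p * F) ^ℚ 3 * G ^ℚ 2      ∎
  where
  p = β ^ℚ (4 ℕ.* n)
  q = β ^ℚ (6 ℕ.* n)

discriminant≢0⇒nonzero : ∀ {A′ B′ A B} → fromℤ (+ 4) * A′ ^ℚ 3 + fromℤ (+ 27) * B′ ^ℚ 2 ≢ 0ℚ →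
                         A′ ≡ A → B′ ≡ B → ¬ (A ≡ 0ℚ × B ≡ 0ℚ)
discriminant≢0⇒nonzero disc refl refl (refl , refl) = disc refl

map-injectiveOn⁺ : ∀ {X Y : Set} (P : X → Set) (h : X → Y) →
                   (∀ x y → P x → P y → h x ≡ h y → x ≡ y) →
                   ∀ L → Unique L → All P L → Unique (map h L)
map-injectiveOn⁺ P h inj []       _              _           = []
map-injectiveOn⁺ P h inj (x ∷ xs) (x∉xs ∷ uxs) (px ∷ pxs) = distinct xs x∉xs pxs ∷ map-injectiveOn⁺ P h inj xs uxs pxs
  where
  distinct : ∀ ys → All (x ≢_) ys → All P ys → All (h x ≢_) (map h ys)
  distinct []       _              _           = []
  distinct (y ∷ ys) (x≢y ∷ x∉ys) (py ∷ pys) = (λ hx≡hy → x≢y (inj x y px py hx≡hy)) ∷ distinct ys x∉ys pys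

base : ℕ → ℚ
base k = fromℤ +[1+ k ]

base-pos : ∀ k → 0ℚ < base k
base-pos k = ℚP.positive⁻¹ (base k) {{ℚP.normalize-pos (suc k) 1}}

-- The point t = a / b^m of a pair with b > 0 (pairs with b ≤ 0 never occur below).
point : ℕ → ℤ × ℤ → ℚ
point m (a , +[1+ k ]) = ℚ._/_ a (suc k ℕ.^ m) {{ℕP.m^n≢0 (suc k) m}}
point m _              = 0ℚ

relationPoly-nonvanishing : ∀ f g {r s A B} → HasDegree f r → HasDegree g s → (0 ℕ.< r ⊎ 0 ℕ.< s) →
  CoprimeInℚ[t] f g → ¬ (A ≡ 0ℚ × B ≡ 0ℚ) → ¬ (∀ x → evalP (relationPoly (toℚ[t] f) (toℚ[t] g) A B) x ≡ 0ℚ)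
relationPoly-nonvanishing f g {A = A} {B} f-deg g-deg positive coprime nonzero P≡0 =
  nonzero (WeightedRelation.relation⇒trivial f g f-deg g-deg coprime A B relation positive)
  where
  relation : ∀ x → B ^ℚ 2 * evalP (toℚ[t] f) x ^ℚ 3 ≡ A ^ℚ 3 * evalP (toℚ[t] g) x ^ℚ 2
  relation x = x-y≡0⇒x≡y _ _ (trans (sym (relationPoly-eval (toℚ[t] f) (toℚ[t] g) A B x)) (P≡0 x))

fiberSizeBound : List ℤ → List ℤ → ℕ
fiberSizeBound f g = length (toℚ[t] f ^ₚ 3) ℕ.⊔ length (toℚ[t] g ^ₚ 2)

module Fibers (f g : List ℤ) (n m : ℕ) where
  private
    F G : Poly
    F = toℚ[t] f
    G = toℚ[t] g

  InFiber : ℚ → ℚ → ℤ × ℤ → Set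
  InFiber A B (a , b) = ℤ.0ℤ ℤ.< b × Aof f n m a b ≡ A × Bof g n m a b ≡ B

  InS₂Fiber : ℚ → ℚ → ℚ → ℚ → ℤ × ℤ → Set
  InS₂Fiber κ X A B (a , b) = InS₂ f g n m κ X a b × Aof f n m a b ≡ A × Bof g n m a b ≡ B

  -- t = a/b^m is a root of the relation polynomial, as A = b^{4n}f(t), B = b^{6n}g(t).
  fiber-root : ∀ {A B} p → InFiber A B p → Root (relationPoly F G A B) (point m p)
  fiber-root {A} {B} (a , +[1+ k ]) (_ , A≡ , B≡) = begin
      evalP (relationPoly F G A B) t
        ≡⟨ relationPoly-eval F G A B t ⟩
      B ^ℚ 2 * evalP F t ^ℚ 3 - A ^ℚ 3 * evalP G t ^ℚ 2
        ≡⟨ cong₂ (λ A B → B ^ℚ 2 * evalP F t ^ℚ 3 - A ^ℚ 3 * evalP G t ^ℚ 2)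
                 (trans (cong (p *_) (sym (eval≡evalP f t))) A≡) (trans (cong (q *_) (sym (eval≡evalP g t))) B≡) ⟨
      (q * evalP G t) ^ℚ 2 * evalP F t ^ℚ 3 - (p * evalP F t) ^ℚ 3 * evalP G t ^ℚ 2
        ≡⟨ x≡y⇒x-y≡0 (weightedValues-relation (base k) n (evalP F t) (evalP G t)) ⟩
      0ℚ ∎
    where
    t = point m (a , +[1+ k ])
    p = base k ^ℚ (4 ℕ.* n)
    q = base k ^ℚ (6 ℕ.* n)
  fiber-root (a , + zero)   (ℤ.+<+ () , _)
  fiber-root (a , -[1+ k ]) (() , _)

  -- Given t, the denominator b is determined: one of f(t), g(t) is nonzero,
  -- and b^{4n} f(t) = A, b^{6n} g(t) = B recover b from it.
  denominator-determined : ∀ {A B} → 0 ℕ.< n → ¬ (A ≡ 0ℚ × B ≡ 0ℚ) → ∀ k k′ t →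
    base k ^ℚ (4 ℕ.* n) * eval f t ≡ A → base k′ ^ℚ (4 ℕ.* n) * eval f t ≡ A →
    base k ^ℚ (6 ℕ.* n) * eval g t ≡ B → base k′ ^ℚ (6 ℕ.* n) * eval g t ≡ B → base k ≡ base k′
  denominator-determined 0<n nonzero k k′ t A≡ A≡′ B≡ B≡′ with eval f t ℚP.≟ 0ℚ
  ... | no  f≢0 = ^-*-cancel (4 ℕ.* n) (ℕP.<-≤-trans 0<n (ℕP.m≤n*m n 4)) (base-pos k) (base-pos k′) f≢0
                    (trans A≡ (sym A≡′))
  ... | yes f≡0 = ^-*-cancel (6 ℕ.* n) (ℕP.<-≤-trans 0<n (ℕP.m≤n*m n 6)) (base-pos k) (base-pos k′) g≢0
                    (trans B≡ (sym B≡′))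
    where
    g≢0 : eval g t ≢ 0ℚ
    g≢0 g≡0 = nonzero (trans (sym A≡) (trans (cong (p *_) f≡0) (ℚP.*-zeroʳ p)) ,
                       trans (sym B≡) (trans (cong (q *_) g≡0) (ℚP.*-zeroʳ q)))
      where
      p = base k ^ℚ (4 ℕ.* n)
      q = base k ^ℚ (6 ℕ.* n)

  -- Hence t determines the whole pair: a = t·b^m.
  point-injective : ∀ {A B} → 0 ℕ.< n → ¬ (A ≡ 0ℚ × B ≡ 0ℚ) →
                    ∀ p p′ → InFiber A B p → InFiber A B p′ → point m p ≡ point m p′ → p ≡ p′
  point-injective {A} {B} 0<n nonzero (a , +[1+ k ]) (a′ , +[1+ k′ ]) (_ , A≡ , B≡) (_ , A≡′ , B≡′) t≡t′
    with fromℤ-injective {+[1+ k ]} {+[1+ k′ ]} (denominator-determined 0<n nonzero k k′ (point m (a , +[1+ k ])) A≡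
           (subst (λ s → base k′ ^ℚ (4 ℕ.* n) * eval f s ≡ A) (sym t≡t′) A≡′) B≡
           (subst (λ s → base k′ ^ℚ (6 ℕ.* n) * eval g s ≡ B) (sym t≡t′) B≡′))
  ... | refl = cong (_, +[1+ k ]) (/-injectiveˡ a a′ (suc k ℕ.^ m) {{ℕP.m^n≢0 (suc k) m}} t≡t′)
  point-injective _ _ (a , + zero)   _                (ℤ.+<+ () , _) _
  point-injective _ _ (a , -[1+ k ]) _                (() , _)        _
  point-injective _ _ (a , +[1+ k ]) (a′ , + zero)    _ (ℤ.+<+ () , _)
  point-injective _ _ (a , +[1+ k ]) (a′ , -[1+ k′ ]) _ (() , _)

  fiber-bound : ∀ {A B} → ¬ (∀ x → evalP (relationPoly F G A B) x ≡ 0ℚ) → 0 ℕ.< n → ¬ (A ≡ 0ℚ × B ≡ 0ℚ) →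
                ∀ L → Unique L → All (InFiber A B) L → length L ℕ.< length (relationPoly F G A B)
  fiber-bound {A} {B} P≢0 0<n nonzero L uL inL = subst (ℕ._< _) (ListP.length-map (point m) L)
    (distinctRoots<length (relationPoly F G A B) (map (point m) L) P≢0
       (map-injectiveOn⁺ (InFiber A B) (point m) (point-injective 0<n nonzero) L uL inL)
       (AllP.map⁺ (All.map (λ {p} → fiber-root p) inL)))

  S₂-fiber-bound : ∀ {r s} → HasDegree f r → HasDegree g s → (0 ℕ.< r ⊎ 0 ℕ.< s) → CoprimeInℚ[t] f g →
                   0 ℕ.< n → ∀ κ X A B L → Unique L → All (InS₂Fiber κ X A B) L → length L ℕ.≤ fiberSizeBound f g
  S₂-fiber-bound _ _ _ _ _ κ X A B []         _  _ = z≤n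
  S₂-fiber-bound f-deg g-deg positive coprime 0<n κ X A B L@(_ ∷ _) uL
                 members@(((_ , _ , _ , _ , disc) , A≡ , B≡) ∷ _) =
    ℕP.<⇒≤ (subst (length L ℕ.<_) (relationPoly-length F G A B)
      (fiber-bound (relationPoly-nonvanishing f g f-deg g-deg positive coprime nonzero) 0<n nonzero L uL
         (All.map (λ ((_ , 0<b , _) , A≡ , B≡) → 0<b , A≡ , B≡) members)))
    where
    nonzero : ¬ (A ≡ 0ℚ × B ≡ 0ℚ)
    nonzero = discriminant≢0⇒nonzero disc A≡ B≡

lemma2p8 : (f g : List ℤ) (r s n m : ℕ) .{{_ : NonZero m}} →
    HasDegree f r → HasDegree g s → (0 ℕ.< r ⊎ 0 ℕ.< s) →
    CoprimeInℚ[t] f g →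
    ((+ r ℚ./ 4) ⊔ (+ s ℚ./ 6) ≡ (+ n ℚ./ m)) → 0 ℕ.< n → Coprime n m →
    (n ≡ 1 ⊎ m ≡ 1) →
    (κ : ℚ) → 0ℚ ℚ.< κ →
    ∃ λ (M : ℕ) → ∀ (X : ℚ) → 1ℚ ℚ.≤ X → ∀ (A B : ℚ) →
      (L : List (ℤ × ℤ)) → Unique L →
      All (λ { (a , b) → InS₂ f g n m κ X a b × Aof f n m a b ≡ A × Bof g n m a b ≡ B }) L →
      length L ℕ.≤ M
lemma2p8 f g r s n m f-deg g-deg positive coprime _ 0<n _ _ κ _ =
  fiberSizeBound f g , λ X _ A B → Fibers.S₂-fiber-bound f g n m f-deg g-deg positive coprime 0<n κ X A B
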